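{- Let $\mathcal D$ be a maximal ASPD on an $n$-element set $A$ and let $\mathcal V=\{\{\omega(1),\dots,\omega(k)\}:\omega\in\mathcal D,\ 1\le k\le n\}$. Then $$\operatorname{rich}(\mathcal D)=\min\Big\{k\in[n]:\ \bigcap_{S\in\mathcal V,\ |S|=k}S\ne\varnothing\Big\}.$$
   Context: Preferences: bijections $\omega\colon[n]\to A$, written $\omega(1)\cdots\omega(n)$; $\mathcal L(A)$ all preferences; domain = subset of $\mathcal L(A)$; $\mathcal D_S$ = restrictions to $S\subseteq A$ keeping relative order; $x$ is a bottom alternative of $\mathcal D$ if $\omega(|A|)=x$ for some $\omega\in\mathcal D$. ASPD: for every 3-element $T\subseteq A$ some $x\in T$ is not a bottom alternative of $\mathcal D_T$; maximal: not properly contained in another ASPD in $\mathcal L(A)$. A domain is $k$-rich if for every $j\le k$ and $a\in A$ some $\omega\in\mathcal D$ has $\omega(j)=a$; $\operatorname{rich}(\mathcal D)$ is the $k$ with $\mathcal D$ $k$-rich but not $(k+1)$-rich. ($\mathcal V$ is the regular vine corresponding to $\mathcal D$.) -}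

module Defs where

open import Data.Nat using (ℕ; suc; _≤_; _<_)
open import Data.Fin using (Fin; toℕ)
open import Data.Fin.Subset using (Subset; _∈_; ∣_∣; ⋃; ⁅_⁆)
open import Data.Fin.Subset.Properties using (_∈?_)
open import Data.Vec using (Vec; lookup; toList)
open import Data.Vec.Relation.Unary.Unique.Propositional using (Unique)
open import Data.List using (List; filter; take; last)
import Data.List as List
open import Data.Maybe using (Maybe; just)
open import Data.Bool using (Bool; true; false)
open import Data.Product using (Σ; ∃; _×_)
open import Relation.Binary.PropositionalEquality using (_≡_)
open import Relation.Nullary using (¬_)

-- The alternative set A is Fin n.
-- A preference ω : [n] → A is written as the word ω(1)⋯ω(n), i.e. a vector
-- of length n with pairwise distinct entries (an injection Fin n → Fin n,
-- hence a bijection). Position j (1-based) is index j-1 (0-based).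
Word : ℕ → Set
Word n = Vec (Fin n) n

IsPreference : ∀ {n} → Word n → Set
IsPreference ω = Unique ω

Domain : ℕ → Set
Domain n = Word n → Bool

IsDomain : ∀ {n} → Domain n → Set
IsDomain {n} D = (ω : Word n) → D ω ≡ true → IsPreference ω

_⊆D_ : ∀ {n} → Domain n → Domain n → Set
_⊆D_ {n} D D′ = (ω : Word n) → D ω ≡ true → D′ ω ≡ true

restrict : ∀ {n} → Subset n → Word n → List (Fin n)
restrict S ω = filter (_∈? S) (toList ω)

IsBottomOfRestriction : ∀ {n} → Domain n → Subset n → Fin n → Set
IsBottomOfRestriction {n} D T x =
  Σ (Word n) λ ω → D ω ≡ true × last (restrict T ω) ≡ just x

IsASPD : ∀ {n} → Domain n → Set
IsASPD {n} D =
  IsDomain D ×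
  ((T : Subset n) → ∣ T ∣ ≡ 3 →
     Σ (Fin n) λ x → x ∈ T × ¬ IsBottomOfRestriction D T x)

IsMaximalASPD : ∀ {n} → Domain n → Set
IsMaximalASPD {n} D =
  IsASPD D ×
  ¬ (Σ (Domain n) λ D′ → IsASPD D′ × D ⊆D D′ ×
       Σ (Word n) λ ω → D′ ω ≡ true × D ω ≡ false)

-- k-rich: for every 1 ≤ j ≤ k and every a some ω ∈ 𝒟 has ω(j) = a.
-- Positions beyond n do not exist, so k-rich forces k ≤ n.
IsRich : ∀ {n} → Domain n → ℕ → Set
IsRich {n} D k =
  k ≤ n ×
  ((j : Fin n) → toℕ j < k → (a : Fin n) →
     Σ (Word n) λ ω → D ω ≡ true × lookup ω j ≡ a)

RichIs : ∀ {n} → Domain n → ℕ → Set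
RichIs D r = IsRich D r × ¬ IsRich D (suc r)

prefixSet : ∀ {n} → Word n → ℕ → Subset n
prefixSet ω k = ⋃ (List.map ⁅_⁆ (take k (toList ω)))

InV : ∀ {n} → Domain n → Subset n → Set
InV {n} D S =
  Σ (Word n) λ ω → D ω ≡ true × Σ ℕ λ k → 1 ≤ k × k ≤ n × prefixSet ω k ≡ S

LevelIntersectionNonempty : ∀ {n} → Domain n → ℕ → Set
LevelIntersectionNonempty {n} D k =
  Σ (Fin n) λ a → (S : Subset n) → InV D S → ∣ S ∣ ≡ k → a ∈ S

IsMinIn[n] : ℕ → (ℕ → Set) → ℕ → Set
IsMinIn[n] n P m =
  (1 ≤ m × m ≤ n × P m) × ((k : ℕ) → 1 ≤ k → k ≤ n → P k → m ≤ k)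

{-# OPTIONS --safe #-}
-- Call the set of positions at which an alternative a occurs in preferences of 𝒟
-- the reach of a. In a maximal ASPD every reach is an initial segment of [n]: if
-- ω ∈ 𝒟 has a = ω(p+1) with p ≥ 1, moving a suitable alternative of ω(1), …, ω(p)
-- to position p+1 puts a at position p, and by maximality the new preference lies
-- in 𝒟 as soon as every triple keeps an alternative that is a bottom alternative
-- neither of 𝒟 nor of the new preference. If some ω₂ ∈ 𝒟 ranks a above an
-- alternative that ω ranks above a, move the alternative among ω(1), …, ω(p+1)
-- that ω₂ ranks last (it is not a): the new preference ends every triple where ω
-- or ω₂ already ends it. Otherwise swap a with ω(p): in a triple {ω(p), a, e}
-- the alternative e stays never-bottom, since a preference of 𝒟 ending it in e
-- would rank a above e.
-- Hence rich(𝒟) is the least r such that some alternative a does not reach position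
-- r+1 (or n): that a lies in every set of 𝒱 of size r, while for k < r every
-- alternative occupies position k+1 of some ω ∈ 𝒟 and so misses {ω(1), …, ω(k)}.
module Submission where

open import Defs
open import Data.Bool using (true; false; _∨_)
import Data.Bool as Bool
import Data.Bool.Properties as Bool
open import Data.Empty using (⊥-elim)
open import Data.Fin as Fin using (Fin; zero; suc; toℕ; fromℕ<; punchIn; punchOut)
import Data.Fin.Properties as Fin
open import Data.Fin.Permutation using (Permutation′; _⟨$⟩ʳ_; _⟨$⟩ˡ_; inverseˡ; inverseʳ; insert; insert-punchIn)
import Data.Fin.Permutation as Permutation
open import Data.Fin.Subset using (Subset; _∈_; _∉_; _⊆_; ∣_∣; ⁅_⁆; _∪_; ⋃; outside; inside)
import Data.Fin.Subset.Properties as Subset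
open import Data.Fin.Subset.Properties using (_∈?_)
open import Data.List as List using (filter; last; take)
open import Data.Maybe using (just; nothing; fromMaybe)
import Data.Maybe.Properties as Maybe
open import Data.Nat as ℕ using (ℕ; zero; suc; _≤_; _<_; z≤n; s≤s)
import Data.Nat.Properties as ℕ
open import Data.Product using (Σ; ∃; _×_; _,_; proj₁; proj₂)
open import Data.Sum using (_⊎_; inj₁; inj₂)
open import Data.Vec as Vec using (Vec; []; _∷_; lookup; toList; tabulate)
import Data.Vec.Properties as Vec
open import Data.Vec.Relation.Unary.Unique.Propositional using (Unique)
open import Data.Vec.Relation.Unary.Unique.Propositional.Properties using (lookup-injective; tabulate⁺)
import Data.Vec.Relation.Unary.AllPairs as AllPairs
import Data.Vec.Relation.Unary.All.Properties as All
open import Function using (_∘_)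
open import Function.Definitions using (Injective)
open import Level using (_⊔_; 0ℓ)
open import Relation.Binary.Definitions using (DecidableEquality)
open import Relation.Binary.PropositionalEquality
open import Relation.Nullary using (¬_; ¬?; Dec; yes; no; does; contradiction; _×-dec_)
open import Relation.Nullary.Decidable using (map′; dec-true)
open import Relation.Unary using (Pred; Decidable)

-- Positions in a preference

injective⇒surjective : ∀ {n} (f : Fin n → Fin n) → Injective _≡_ _≡_ f →
                       ∀ z → ∃ λ i → f i ≡ z
injective⇒surjective {suc m} f f-inj z with Fin.any? (λ i → f i Fin.≟ z)
... | yes hit = hit
... | no miss = contradiction (Fin.injective⇒≤ g-inj) (ℕ.n≮n m)
  where
  g : Fin (suc m) → Fin m
  g i = punchOut (miss ∘ (i ,_) ∘ sym)
  g-inj : Injective _≡_ _≡_ g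
  g-inj {i} {j} = f-inj ∘ Fin.punchOut-injective {i = z} (miss ∘ (i ,_) ∘ sym) (miss ∘ (j ,_) ∘ sym)

-- For a preference every alternative occurs, so the fallback value z is never used.
position : ∀ {n} → Word n → Fin n → Fin n
position ω z with Fin.any? (λ i → lookup ω i Fin.≟ z)
... | yes (i , _) = i
... | no _        = z

module _ {n} {ω : Word n} (ω-pref : Unique ω) where

  lookup-position : ∀ z → lookup ω (position ω z) ≡ z
  lookup-position z with Fin.any? (λ i → lookup ω i Fin.≟ z)
  ... | yes (_ , hit) = hit
  ... | no miss = contradiction (injective⇒surjective (lookup ω) (lookup-injective ω-pref _ _) z) miss

  position-lookup : ∀ i → position ω (lookup ω i) ≡ i
  position-lookup i = lookup-injective ω-pref _ _ (lookup-position (lookup ω i))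

  position-injective : ∀ {z w} → position ω z ≡ position ω w → z ≡ w
  position-injective {z} {w} eq = begin
    z                       ≡⟨ lookup-position z ⟨
    lookup ω (position ω z) ≡⟨ cong (lookup ω) eq ⟩
    lookup ω (position ω w) ≡⟨ lookup-position w ⟩
    w                       ∎
    where open ≡-Reasoning

last-∷ : ∀ {a} {A : Set a} (x : A) xs → last (x List.∷ xs) ≡ just (fromMaybe x (last xs))
last-∷ x List.[]        = refl
last-∷ x (y List.∷ xs) rewrite last-∷ y xs = refl

module _ {a p} {A : Set a} {P : Pred A p} (P? : Decidable P) where

  LastSatisfying : ∀ {m} → Vec A m → A → Set (a ⊔ p)
  LastSatisfying {m} v x =
    ∃ λ (i : Fin m) → lookup v i ≡ x × P x × ∀ j → i Fin.< j → ¬ P (lookup v j)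

  last-filter-nothing⁻ : ∀ {m} (v : Vec A m) → last (filter P? (toList v)) ≡ nothing →
                         ∀ j → ¬ P (lookup v j)
  last-filter-nothing⁻ (x ∷ v) eq j with P? x
  last-filter-nothing⁻ (x ∷ v) eq j       | yes _  =
    contradiction (trans (sym (last-∷ x (filter P? (toList v)))) eq) λ ()
  last-filter-nothing⁻ (x ∷ v) eq zero    | no ¬px = ¬px
  last-filter-nothing⁻ (x ∷ v) eq (suc j) | no _   = last-filter-nothing⁻ v eq j

  last-filter-nothing⁺ : ∀ {m} (v : Vec A m) → (∀ j → ¬ P (lookup v j)) →
                         last (filter P? (toList v)) ≡ nothing
  last-filter-nothing⁺ []      _    = refl
  last-filter-nothing⁺ (x ∷ v) none with P? x
  ... | yes px = contradiction px (none zero)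
  ... | no _   = last-filter-nothing⁺ v (none ∘ suc)

  private
    LastSatisfying-∷ : ∀ {m} {v : Vec A m} {x} y → LastSatisfying v x → LastSatisfying (y ∷ v) x
    LastSatisfying-∷ _ (i , vᵢ≡x , px , later) =
      suc i , vᵢ≡x , px , λ { zero () ; (suc j) (s≤s i<j) → later j i<j }

  last-filter-just⁻ : ∀ {m} (v : Vec A m) {x} → last (filter P? (toList v)) ≡ just x →
                      LastSatisfying v x
  last-filter-just⁻ (y ∷ v) eq with P? y | last (filter P? (toList v)) in eqᵥ
  ... | yes py | nothing rewrite last-∷ y (filter P? (toList v)) | eqᵥ with refl ← eq =
    zero , refl , py , λ { zero () ; (suc j) _ → last-filter-nothing⁻ v eqᵥ j }
  ... | yes _  | just _ rewrite last-∷ y (filter P? (toList v)) | eqᵥ with refl ← eq =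
    LastSatisfying-∷ y (last-filter-just⁻ v eqᵥ)
  ... | no _   | _ = LastSatisfying-∷ y (last-filter-just⁻ v eq)

  last-filter-just⁺ : ∀ {m} (v : Vec A m) {x} → LastSatisfying v x →
                      last (filter P? (toList v)) ≡ just x
  last-filter-just⁺ (y ∷ v) (zero , refl , py , later) with P? y
  ... | no ¬py = contradiction py ¬py
  ... | yes _ rewrite last-∷ y (filter P? (toList v))
                    | last-filter-nothing⁺ v (λ j → later (suc j) (s≤s z≤n)) = refl
  last-filter-just⁺ (y ∷ v) (suc i , vᵢ≡x , px , later)
    with P? y | last-filter-just⁺ v (i , vᵢ≡x , px , λ j i<j → later (suc j) (s≤s i<j))
  ... | no _  | ih = ih
  ... | yes _ | ih rewrite last-∷ y (filter P? (toList v)) | ih = refl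

  last-filter-just-exists : ∀ {m} (v : Vec A m) i → P (lookup v i) →
                            ∃ λ x → last (filter P? (toList v)) ≡ just x
  last-filter-just-exists v i pvᵢ with last (filter P? (toList v)) in eq
  ... | just x  = x , refl
  ... | nothing = contradiction pvᵢ (last-filter-nothing⁻ v eq i)

RanksLast : ∀ {n} → Word n → Subset n → Fin n → Set
RanksLast ω T x = x ∈ T × ∀ z → z ∈ T → position ω z Fin.≤ position ω x

module _ {n} {ω : Word n} (ω-pref : Unique ω) (T : Subset n) where

  restrict-last⇒RanksLast : ∀ {x} → last (restrict T ω) ≡ just x → RanksLast ω T x
  restrict-last⇒RanksLast eq with last-filter-just⁻ (_∈? T) ω eq
  ... | i , refl , ωᵢ∈T , later = ωᵢ∈T , λ z z∈T →
    subst (position ω z Fin.≤_) (sym (position-lookup ω-pref i))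
      (ℕ.≮⇒≥ λ i<z → later _ i<z (subst (_∈ T) (sym (lookup-position ω-pref z)) z∈T))

  RanksLast⇒restrict-last : ∀ {x} → RanksLast ω T x → last (restrict T ω) ≡ just x
  RanksLast⇒restrict-last {x} (x∈T , x-last) =
    last-filter-just⁺ (_∈? T) ω (position ω x , lookup-position ω-pref x , x∈T , later∉T)
    where
    later∉T : ∀ j → position ω x Fin.< j → lookup ω j ∉ T
    later∉T j x<j ωⱼ∈T = ℕ.<⇒≱ x<j
      (subst (Fin._≤ position ω x) (position-lookup ω-pref j) (x-last _ ωⱼ∈T))

  RanksLast-exists : ∀ {y} → y ∈ T → ∃ (RanksLast ω T)
  RanksLast-exists {y} y∈T =
    let x , eq = last-filter-just-exists (_∈? T) ω (position ω y)
                   (subst (_∈ T) (sym (lookup-position ω-pref y)) y∈T)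
    in x , restrict-last⇒RanksLast eq

-- prefixSet, for vectors of any length; prefixSet ω k is prefix ω k by definition.
prefix : ∀ {n m} → Vec (Fin n) m → ℕ → Subset n
prefix v k = ⋃ (List.map ⁅_⁆ (take k (toList v)))

prefix-∈⁻ : ∀ {n m} (v : Vec (Fin n) m) k {z} → z ∈ prefix v k →
            ∃ λ i → toℕ i < k × lookup v i ≡ z
prefix-∈⁻ v       zero    z∈ = contradiction z∈ Subset.∉⊥
prefix-∈⁻ []      (suc k) z∈ = contradiction z∈ Subset.∉⊥
prefix-∈⁻ (x ∷ v) (suc k) z∈ with Subset.x∈p∪q⁻ ⁅ x ⁆ (prefix v k) z∈
... | inj₁ z∈⁅x⁆ = zero , s≤s z≤n , sym (Subset.x∈⁅y⁆⇒x≡y x z∈⁅x⁆)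
... | inj₂ z∈pre with prefix-∈⁻ v k z∈pre
...   | i , i<k , vᵢ≡z = suc i , s≤s i<k , vᵢ≡z

prefix-∈⁺ : ∀ {n m} (v : Vec (Fin n) m) k i → toℕ i < k → lookup v i ∈ prefix v k
prefix-∈⁺ (x ∷ v) (suc k) zero    _         = Subset.x∈p∪q⁺ (inj₁ (Subset.x∈⁅x⁆ x))
prefix-∈⁺ (x ∷ v) (suc k) (suc i) (s≤s i<k) = Subset.x∈p∪q⁺ {p = ⁅ x ⁆} (inj₂ (prefix-∈⁺ v k i i<k))

module _ {n} {ω : Word n} (ω-pref : Unique ω) where

  ∈prefix⁻ : ∀ {k z} → z ∈ prefix ω k → toℕ (position ω z) < k
  ∈prefix⁻ {k} z∈ with prefix-∈⁻ ω k z∈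
  ... | i , i<k , refl = subst (λ j → toℕ j < k) (sym (position-lookup ω-pref i)) i<k

  ∈prefix⁺ : ∀ {k z} → toℕ (position ω z) < k → z ∈ prefix ω k
  ∈prefix⁺ {k} {z} z<k = subst (_∈ prefix ω k) (lookup-position ω-pref z) (prefix-∈⁺ ω k _ z<k)

∣⁅x⁆∪p∣≤1+∣p∣ : ∀ {n} (x : Fin n) (p : Subset n) → ∣ ⁅ x ⁆ ∪ p ∣ ≤ suc ∣ p ∣
∣⁅x⁆∪p∣≤1+∣p∣ zero    (outside ∷ p) rewrite Subset.∪-identityˡ p = ℕ.≤-refl
∣⁅x⁆∪p∣≤1+∣p∣ zero    (inside ∷ p)  rewrite Subset.∪-identityˡ p = ℕ.n≤1+n _
∣⁅x⁆∪p∣≤1+∣p∣ (suc x) (outside ∷ p) = ∣⁅x⁆∪p∣≤1+∣p∣ x p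
∣⁅x⁆∪p∣≤1+∣p∣ (suc x) (inside ∷ p)  = s≤s (∣⁅x⁆∪p∣≤1+∣p∣ x p)

x∉p⇒∣⁅x⁆∪p∣≡1+∣p∣ : ∀ {n} {x : Fin n} {p : Subset n} → x ∉ p → ∣ ⁅ x ⁆ ∪ p ∣ ≡ suc ∣ p ∣
x∉p⇒∣⁅x⁆∪p∣≡1+∣p∣ {x = zero}  {outside ∷ p} _   rewrite Subset.∪-identityˡ p = refl
x∉p⇒∣⁅x⁆∪p∣≡1+∣p∣ {x = zero}  {inside ∷ p}  x∉p = contradiction Vec.here x∉p
x∉p⇒∣⁅x⁆∪p∣≡1+∣p∣ {x = suc x} {outside ∷ p} x∉p = x∉p⇒∣⁅x⁆∪p∣≡1+∣p∣ (x∉p ∘ Vec.there)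
x∉p⇒∣⁅x⁆∪p∣≡1+∣p∣ {x = suc x} {inside ∷ p}  x∉p = cong suc (x∉p⇒∣⁅x⁆∪p∣≡1+∣p∣ (x∉p ∘ Vec.there))

∣prefix∣ : ∀ {n m} (v : Vec (Fin n) m) {k} → Unique v → k ≤ m → ∣ prefix v k ∣ ≡ k
∣prefix∣ {n} v       {zero}  _                _         = Subset.∣⊥∣≡0 n
∣prefix∣     (x ∷ v) {suc k} (x∉v AllPairs.∷ v-unique) (s≤s k≤m) =
  trans (x∉p⇒∣⁅x⁆∪p∣≡1+∣p∣ x∉prefix) (cong suc (∣prefix∣ v v-unique k≤m))
  where
  x∉prefix : x ∉ prefix v k
  x∉prefix x∈ with prefix-∈⁻ v k x∈
  ... | i , _ , vᵢ≡x = All.lookup⁺ x∉v i (sym vᵢ≡x)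

member-avoiding : ∀ {n} (T : Subset n) → ∣ T ∣ ≡ 3 → ∀ x y → ∃ λ e → e ∈ T × e ≢ x × e ≢ y
member-avoiding T ∣T∣≡3 x y
  with Fin.any? (λ e → (e ∈? T) ×-dec (¬? (e Fin.≟ x)) ×-dec (¬? (e Fin.≟ y)))
... | yes found = found
... | no none = contradiction (subst (_≤ 2) ∣T∣≡3 ∣T∣≤2) (ℕ.n≮n 2)
  where
  T⊆⁅x⁆∪⁅y⁆ : T ⊆ ⁅ x ⁆ ∪ ⁅ y ⁆
  T⊆⁅x⁆∪⁅y⁆ {e} e∈T with e Fin.≟ x | e Fin.≟ y
  ... | yes refl | _        = Subset.x∈p∪q⁺ (inj₁ (Subset.x∈⁅x⁆ e))
  ... | no _     | yes refl = Subset.x∈p∪q⁺ {p = ⁅ x ⁆} (inj₂ (Subset.x∈⁅x⁆ e))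
  ... | no e≢x   | no e≢y   = contradiction (e , e∈T , e≢x , e≢y) none
  ∣T∣≤2 : ∣ T ∣ ≤ 2
  ∣T∣≤2 = ℕ.≤-trans (Subset.p⊆q⇒∣p∣≤∣q∣ T⊆⁅x⁆∪⁅y⁆)
            (subst (λ c → ∣ ⁅ x ⁆ ∪ ⁅ y ⁆ ∣ ≤ suc c) (Subset.∣⁅x⁆∣≡1 y) (∣⁅x⁆∪p∣≤1+∣p∣ x ⁅ y ⁆))

-- Moving one entry of a word

permute : ∀ {a} {A : Set a} {n} → Permutation′ n → Vec A n → Vec A n
permute π v = tabulate (λ j → lookup v (π ⟨$⟩ˡ j))

module _ {a} {A : Set a} {n} (π : Permutation′ n) where

  lookup-permute : ∀ (v : Vec A n) i → lookup (permute π v) (π ⟨$⟩ʳ i) ≡ lookup v i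
  lookup-permute v i = trans (Vec.lookup∘tabulate _ (π ⟨$⟩ʳ i)) (cong (lookup v) (inverseˡ π))

  permute-unique : ∀ {v : Vec A n} → Unique v → Unique (permute π v)
  permute-unique v-unique = tabulate⁺ λ {j} {j′} eq → begin
    j                  ≡⟨ inverseʳ π ⟨
    π ⟨$⟩ʳ (π ⟨$⟩ˡ j)  ≡⟨ cong (π ⟨$⟩ʳ_) (lookup-injective v-unique _ _ eq) ⟩
    π ⟨$⟩ʳ (π ⟨$⟩ˡ j′) ≡⟨ inverseʳ π ⟩
    j′                 ∎
    where open ≡-Reasoning

position-permute : ∀ {n} (π : Permutation′ n) {ω : Word n} → Unique ω →
                   ∀ z → position (permute π ω) z ≡ π ⟨$⟩ʳ position ω z
position-permute π {ω} ω-pref z = lookup-injective (permute-unique π ω-pref) _ _ (begin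
  lookup (permute π ω) (position (permute π ω) z) ≡⟨ lookup-position (permute-unique π ω-pref) z ⟩
  z                                               ≡⟨ lookup-position ω-pref z ⟨
  lookup ω (position ω z)                         ≡⟨ lookup-permute π ω (position ω z) ⟨
  lookup (permute π ω) (π ⟨$⟩ʳ position ω z)      ∎)
  where open ≡-Reasoning

toℕ-punchIn-< : ∀ {m} (i : Fin (suc m)) (j : Fin m) → toℕ j < toℕ i → toℕ (punchIn i j) ≡ toℕ j
toℕ-punchIn-< (suc i) zero    _         = refl
toℕ-punchIn-< (suc i) (suc j) (s≤s j<i) = cong suc (toℕ-punchIn-< i j j<i)

toℕ-punchIn-≥ : ∀ {m} (i : Fin (suc m)) (j : Fin m) → toℕ i ≤ toℕ j → toℕ (punchIn i j) ≡ suc (toℕ j)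
toℕ-punchIn-≥ zero    j       _         = refl
toℕ-punchIn-≥ (suc i) (suc j) (s≤s i≤j) = cong suc (toℕ-punchIn-≥ i j i≤j)

toℕ-punchIn-≤ : ∀ {m} (i : Fin (suc m)) (j : Fin m) → toℕ (punchIn i j) ≤ suc (toℕ j)
toℕ-punchIn-≤ zero    j       = ℕ.≤-refl
toℕ-punchIn-≤ (suc i) zero    = z≤n
toℕ-punchIn-≤ (suc i) (suc j) = s≤s (toℕ-punchIn-≤ i j)

-- permute (move q p) ω is ω with its entry at position q moved to position p.
move : ∀ {n} → Fin n → Fin n → Permutation′ n
move {suc m} q p = insert q p Permutation.id

move-source : ∀ {n} (q p : Fin n) → move q p ⟨$⟩ʳ q ≡ p
move-source {suc m} q p with q Fin.≟ q
... | yes _   = refl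
... | no q≢q = contradiction refl q≢q

move-punchIn : ∀ {m} (q p : Fin (suc m)) k → move q p ⟨$⟩ʳ punchIn q k ≡ punchIn p k
move-punchIn q p = insert-punchIn q p Permutation.id

punchIn-view : ∀ {m} {q i : Fin (suc m)} → i ≢ q → ∃ λ k → punchIn q k ≡ i
punchIn-view i≢q = punchOut (i≢q ∘ sym) , Fin.punchIn-punchOut (i≢q ∘ sym)

move-cancel-≤ : ∀ {n} {q p i j : Fin n} → i ≢ q → j ≢ q →
                move q p ⟨$⟩ʳ i Fin.≤ move q p ⟨$⟩ʳ j → i Fin.≤ j
move-cancel-≤ {suc m} {q} {p} i≢q j≢q moved-≤
  with k , refl ← punchIn-view i≢q | k′ , refl ← punchIn-view j≢q =
  Fin.punchIn-mono-≤ q k k′ (Fin.punchIn-cancel-≤ p k k′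
    (subst₂ Fin._≤_ (move-punchIn q p k) (move-punchIn q p k′) moved-≤))

move-≤target : ∀ {n} {q p i : Fin n} → q Fin.< p → i ≢ q →
               move q p ⟨$⟩ʳ i Fin.≤ p → i Fin.≤ p
move-≤target {suc m} {q} {p} q<p i≢q moved-≤p
  with k , refl ← punchIn-view i≢q | toℕ k ℕ.<? toℕ p
... | yes k<p = ℕ.≤-trans (toℕ-punchIn-≤ q k) k<p
... | no k≮p  = contradiction (ℕ.≮⇒≥ k≮p) (ℕ.<⇒≱ (begin-strict
    toℕ k                          <⟨ ℕ.n<1+n (toℕ k) ⟩
    suc (toℕ k)                    ≡⟨ toℕ-punchIn-≥ p k (ℕ.≮⇒≥ k≮p) ⟨
    toℕ (punchIn p k)              ≡⟨ cong toℕ (move-punchIn q p k) ⟨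
    toℕ (move q p ⟨$⟩ʳ punchIn q k) ≤⟨ moved-≤p ⟩
    toℕ p                          ∎))
  where open ℕ.≤-Reasoning

target≤move : ∀ {n} {q p i : Fin n} → q Fin.< p → i ≢ q →
              p Fin.≤ move q p ⟨$⟩ʳ i → p Fin.< i
target≤move {suc m} {q} {p} q<p i≢q p≤moved
  with k , refl ← punchIn-view i≢q | toℕ k ℕ.<? toℕ p
... | yes k<p = contradiction p≤moved (ℕ.<⇒≱ (begin-strict
    toℕ (move q p ⟨$⟩ʳ punchIn q k) ≡⟨ cong toℕ (move-punchIn q p k) ⟩
    toℕ (punchIn p k)              ≡⟨ toℕ-punchIn-< p k k<p ⟩
    toℕ k                          <⟨ k<p ⟩
    toℕ p                          ∎))
  where open ℕ.≤-Reasoning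
... | no k≮p = subst (toℕ p <_) (sym (toℕ-punchIn-≥ q k q≤k)) (s≤s p≤k)
  where
  p≤k : toℕ p ≤ toℕ k
  p≤k = ℕ.≮⇒≥ k≮p
  q≤k : toℕ q ≤ toℕ k
  q≤k = ℕ.<⇒≤ (ℕ.<-≤-trans q<p p≤k)

move-target : ∀ {n} {q p : Fin n} {k} → q Fin.< p → toℕ p ≡ suc k →
              toℕ (move q p ⟨$⟩ʳ p) ≡ k
move-target {suc m} {q} {p} {k} q<p p≡1+k
  with k′ , q[k′]≡p ← punchIn-view (≢-sym (Fin.<⇒≢ q<p)) = begin
  toℕ (move q p ⟨$⟩ʳ p)           ≡⟨ cong (λ i → toℕ (move q p ⟨$⟩ʳ i)) q[k′]≡p ⟨
  toℕ (move q p ⟨$⟩ʳ punchIn q k′) ≡⟨ cong toℕ (move-punchIn q p k′) ⟩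
  toℕ (punchIn p k′)              ≡⟨ toℕ-punchIn-< p k′ (ℕ.≤-reflexive (sym p≡1+k′)) ⟩
  toℕ k′                          ≡⟨ ℕ.suc-injective (trans (sym p≡1+k′) p≡1+k) ⟩
  k                               ∎
  where
  open ≡-Reasoning
  p≡1+k′ : toℕ p ≡ suc (toℕ k′)
  p≡1+k′ with toℕ k′ ℕ.<? toℕ q
  ... | yes k′<q = contradiction (trans (cong toℕ (sym q[k′]≡p)) (toℕ-punchIn-< q k′ k′<q))
                     λ p≡k′ → ℕ.<-asym q<p (subst (_< toℕ q) (sym p≡k′) k′<q)
  ... | no k′≮q = trans (cong toℕ (sym q[k′]≡p)) (toℕ-punchIn-≥ q k′ (ℕ.≮⇒≥ k′≮q))

module _ {n} {ω : Word n} (ω-pref : Unique ω) {q p : Fin n} (q<p : q Fin.< p) where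

  private
    ρ : Permutation′ n
    ρ = move q p

    ρ-order : ∀ {T x} → RanksLast (permute ρ ω) T x →
              ∀ z → z ∈ T → ρ ⟨$⟩ʳ position ω z Fin.≤ ρ ⟨$⟩ʳ position ω x
    ρ-order {x = x} (_ , x-last) z z∈T =
      subst₂ Fin._≤_ (position-permute ρ ω-pref z) (position-permute ρ ω-pref x) (x-last z z∈T)

  restrict-last-moved : ∀ {T x} → last (restrict T (permute ρ ω)) ≡ just x →
                        RanksLast ω T x ⊎ (position ω x ≡ q × ∀ z → z ∈ T → position ω z Fin.≤ p)
  restrict-last-moved {T} {x} ends
    with ρω-last@(x∈T , _) ← restrict-last⇒RanksLast (permute-unique ρ ω-pref) T ends
       | position ω x Fin.≟ q
  ... | yes x↦q = inj₂ (x↦q , within-p)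
    where
    within-p : ∀ z → z ∈ T → position ω z Fin.≤ p
    within-p z z∈T with position ω z Fin.≟ q
    ... | yes z↦q = ℕ.<⇒≤ (subst (Fin._< p) (sym z↦q) q<p)
    ... | no z≢q  = move-≤target q<p z≢q
      (subst (ρ ⟨$⟩ʳ position ω z Fin.≤_) (trans (cong (ρ ⟨$⟩ʳ_) x↦q) (move-source q p))
        (ρ-order ρω-last z z∈T))
  ... | no x≢q = inj₁ (x∈T , below-x)
    where
    below-x : ∀ z → z ∈ T → position ω z Fin.≤ position ω x
    below-x z z∈T with position ω z Fin.≟ q
    ... | yes z↦q = ℕ.<⇒≤ (ℕ.<-trans (subst (Fin._< p) (sym z↦q) q<p) (target≤move q<p x≢q
      (subst (Fin._≤ ρ ⟨$⟩ʳ position ω x) (trans (cong (ρ ⟨$⟩ʳ_) z↦q) (move-source q p))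
        (ρ-order ρω-last z z∈T))))
    ... | no z≢q  = move-cancel-≤ z≢q x≢q (ρ-order ρω-last z z∈T)

-- Extending a maximal ASPD

NeverBottom : ∀ {n} → Domain n → Subset n → Fin n → Set
NeverBottom D T x = ¬ IsBottomOfRestriction D T x

-- Exactly what D ∪ {ω} needs in order to be an ASPD when D is one.
Admissible : ∀ {n} → Domain n → Word n → Set
Admissible D ω =
  ∀ T → ∣ T ∣ ≡ 3 → ∀ x → x ∈ T → NeverBottom D T x → last (restrict T ω) ≡ just x →
  ∃ λ e → e ∈ T × NeverBottom D T e × last (restrict T ω) ≢ just e

_≟ʷ_ : ∀ {n} → DecidableEquality (Word n)
_≟ʷ_ = Vec.≡-dec Fin._≟_

addWord : ∀ {n} → Domain n → Word n → Domain n
addWord D ω w = D w ∨ does (w ≟ʷ ω)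

module _ {n} (D : Domain n) (ω : Word n) where

  addWord-∈⁻ : ∀ {w} → addWord D ω w ≡ true → D w ≡ true ⊎ w ≡ ω
  addWord-∈⁻ {w} w∈ with D w | w ≟ʷ ω
  ... | true  | _        = inj₁ refl
  ... | false | yes w≡ω  = inj₂ w≡ω
  ... | false | no _     = contradiction w∈ λ ()

  addWord-⊇ : D ⊆D addWord D ω
  addWord-⊇ w w∈D rewrite w∈D = refl

  addWord-∋ : addWord D ω ω ≡ true
  addWord-∋ = trans (cong (D ω ∨_) (dec-true (ω ≟ʷ ω) refl)) (Bool.∨-zeroʳ (D ω))

  addWord-neverBottom : ∀ {T x} → NeverBottom D T x → last (restrict T ω) ≢ just x →
                        NeverBottom (addWord D ω) T x
  addWord-neverBottom never ω-not-x (w , w∈ , w-ends) with addWord-∈⁻ w∈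
  ... | inj₁ w∈D  = never (w , w∈D , w-ends)
  ... | inj₂ refl = ω-not-x w-ends

maximal-∋-admissible : ∀ {n} {D : Domain n} {ω} → IsMaximalASPD D → Unique ω → Admissible D ω →
                       D ω ≡ true
maximal-∋-admissible {n} {D} {ω} ((D-dom , D-aspd) , D-max) ω-pref ω-adm with D ω in ω∉D
... | true  = refl
... | false = contradiction (addWord D ω , (dom , aspd) , addWord-⊇ D ω , ω , addWord-∋ D ω , ω∉D) D-max
  where
  dom : IsDomain (addWord D ω)
  dom w w∈ with addWord-∈⁻ D ω w∈
  ... | inj₁ w∈D  = D-dom w w∈D
  ... | inj₂ refl = ω-pref

  aspd : (T : Subset n) → ∣ T ∣ ≡ 3 → ∃ λ x → x ∈ T × NeverBottom (addWord D ω) T x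
  aspd T ∣T∣≡3 with D-aspd T ∣T∣≡3
  ... | x , x∈T , never with Maybe.≡-dec Fin._≟_ (last (restrict T ω)) (just x)
  ...   | no ω-not-x = x , x∈T , addWord-neverBottom D ω never ω-not-x
  ...   | yes ω-ends with ω-adm T ∣T∣≡3 x x∈T never ω-ends
  ...     | e , e∈T , never-e , ω-not-e = e , e∈T , addWord-neverBottom D ω never-e ω-not-e

-- Positions reached by the alternatives of a maximal ASPD

∃Vec? : ∀ {n m} {P : Pred (Vec (Fin n) m) 0ℓ} → Decidable P → Dec (∃ P)
∃Vec? {m = zero}  P? = map′ ([] ,_) (λ { ([] , p) → p }) (P? [])
∃Vec? {m = suc m} P? = map′ (λ (x , v , p) → x ∷ v , p) (λ { (x ∷ v , p) → x , v , p })
                            (Fin.any? λ x → ∃Vec? (P? ∘ (x ∷_)))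

module _ {n} {D : Domain n} (D-max : IsMaximalASPD D) where

  private
    D-pref : ∀ {ω} → D ω ≡ true → Unique ω
    D-pref {ω} = proj₁ (proj₁ D-max) ω

  -- 0-based: a occupies position k+1 of some ω ∈ D.
  Appears : ℕ → Fin n → Set
  Appears k a = ∃ λ ω → D ω ≡ true × ∃ λ j → toℕ j ≡ k × lookup ω j ≡ a

  appears? : ∀ k a → Dec (Appears k a)
  appears? k a = ∃Vec? λ ω → (D ω Bool.≟ true) ×-dec
                   Fin.any? (λ j → (toℕ j ℕ.≟ k) ×-dec (lookup ω j Fin.≟ a))

  Overtaken : Word n → Fin n → Set
  Overtaken ω p = ∃ λ ω₂ → D ω₂ ≡ true × ∃ λ i → i Fin.< p ×
                  position ω₂ (lookup ω p) Fin.< position ω₂ (lookup ω i)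

  overtaken? : ∀ ω p → Dec (Overtaken ω p)
  overtaken? ω p = ∃Vec? λ ω₂ → (D ω₂ Bool.≟ true) ×-dec
                     Fin.any? (λ i → (i Fin.<? p) ×-dec
                                     (position ω₂ (lookup ω p) Fin.<? position ω₂ (lookup ω i)))

  moved-appears : ∀ {ω q p k} → q Fin.< p → toℕ p ≡ suc k → D (permute (move q p) ω) ≡ true →
                  Appears k (lookup ω p)
  moved-appears {ω} {q} {p} q<p p≡1+k moved∈D =
    permute (move q p) ω , moved∈D ,
    move q p ⟨$⟩ʳ p , move-target q<p p≡1+k , lookup-permute (move q p) ω p

  overtaken⇒appears-pred : ∀ {ω p k} → D ω ≡ true → toℕ p ≡ suc k → Overtaken ω p →
                           Appears k (lookup ω p)
  overtaken⇒appears-pred {ω} {p} ω∈D p≡1+k (ω₂ , ω₂∈D , i , i<p , p-before-i) =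
    moved-appears {ω} q<p p≡1+k
      (maximal-∋-admissible D-max (permute-unique (move q p) ω-pref) admissible)
    where
    ω-pref : Unique ω
    ω-pref = D-pref ω∈D
    ω₂-pref : Unique ω₂
    ω₂-pref = D-pref ω₂∈D

    S : Subset n
    S = prefix ω (suc (toℕ p))

    ∈S : ∀ j → j Fin.≤ p → lookup ω j ∈ S
    ∈S j j≤p = ∈prefix⁺ ω-pref
      (subst (λ j′ → toℕ j′ < suc (toℕ p)) (sym (position-lookup ω-pref j)) (s≤s j≤p))

    last₂ : ∃ (RanksLast ω₂ S)
    last₂ = RanksLast-exists ω₂-pref S (∈S p ℕ.≤-refl)
    b : Fin n
    b = proj₁ last₂
    b∈S : b ∈ S
    b∈S = proj₁ (proj₂ last₂)
    b-last : ∀ z → z ∈ S → position ω₂ z Fin.≤ position ω₂ b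
    b-last = proj₂ (proj₂ last₂)
    q : Fin n
    q = position ω b

    q<p : q Fin.< p
    q<p = Fin.≤∧≢⇒< (ℕ.≤-pred (∈prefix⁻ ω-pref b∈S)) λ q≡p →
      ℕ.<⇒≱ p-before-i (subst (λ y → position ω₂ (lookup ω i) Fin.≤ position ω₂ y)
        (trans (sym (lookup-position ω-pref b)) (cong (lookup ω) q≡p))
        (b-last _ (∈S i (ℕ.<⇒≤ i<p))))

    ω₂-ranks-b-last : ∀ {T} → b ∈ T → (∀ z → z ∈ T → position ω z Fin.≤ p) → RanksLast ω₂ T b
    ω₂-ranks-b-last b∈T within-p = b∈T , λ z z∈T → b-last z (∈prefix⁺ ω-pref (s≤s (within-p z z∈T)))

    admissible : Admissible D (permute (move q p) ω)
    admissible T _ x x∈T never ends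
      with restrict-last-moved ω-pref q<p ends
    ... | inj₁ ω-last = ⊥-elim (never (ω , ω∈D , RanksLast⇒restrict-last ω-pref T ω-last))
    ... | inj₂ (x↦q , within-p) with refl ← position-injective ω-pref x↦q =
      ⊥-elim (never (ω₂ , ω₂∈D , RanksLast⇒restrict-last ω₂-pref T (ω₂-ranks-b-last x∈T within-p)))

  ¬overtaken⇒appears-pred : ∀ {ω p k} → D ω ≡ true → toℕ p ≡ suc k → ¬ Overtaken ω p →
                            Appears k (lookup ω p)
  ¬overtaken⇒appears-pred {ω} {p} {k} ω∈D p≡1+k not-overtaken =
    moved-appears {ω} q<p p≡1+k
      (maximal-∋-admissible D-max (permute-unique (move q p) ω-pref) admissible)
    where
    ω-pref : Unique ω
    ω-pref = D-pref ω∈D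

    a : Fin n
    a = lookup ω p

    k<n : k < n
    k<n = ℕ.<-trans (ℕ.n<1+n k) (subst (_< n) p≡1+k (Fin.toℕ<n p))

    q : Fin n
    q = fromℕ< k<n

    q<p : q Fin.< p
    q<p = subst₂ _<_ (sym (Fin.toℕ-fromℕ< _)) (sym p≡1+k) (ℕ.n<1+n k)

    at-p⇒a : ∀ {z} → position ω z ≡ p → z ≡ a
    at-p⇒a {z} z↦p = trans (sym (lookup-position ω-pref z)) (cong (lookup ω) z↦p)

    admissible : Admissible D (permute (move q p) ω)
    admissible T ∣T∣≡3 x x∈T never ends
      with restrict-last-moved ω-pref q<p ends
    ... | inj₁ ω-last = ⊥-elim (never (ω , ω∈D , RanksLast⇒restrict-last ω-pref T ω-last))
    ... | inj₂ (x↦q , within-p) with a ∈? T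
    ...   | no a∉T = ⊥-elim (never (ω , ω∈D , RanksLast⇒restrict-last ω-pref T (x∈T , below-x)))
      where
      below-x : ∀ z → z ∈ T → position ω z Fin.≤ position ω x
      below-x z z∈T = begin
        toℕ (position ω z) ≤⟨ ℕ.≤-pred (subst (toℕ (position ω z) <_) p≡1+k z<p) ⟩
        k                  ≡⟨ Fin.toℕ-fromℕ< k<n ⟨
        toℕ q              ≡⟨ cong toℕ x↦q ⟨
        toℕ (position ω x) ∎
        where
        open ℕ.≤-Reasoning
        z<p : position ω z Fin.< p
        z<p = Fin.≤∧≢⇒< (within-p z z∈T) λ z↦p → a∉T (subst (_∈ T) (at-p⇒a z↦p) z∈T)
    ...   | yes a∈T with member-avoiding T ∣T∣≡3 x a
    ...     | e , e∈T , e≢x , e≢a =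
      e , e∈T , never-e , λ ends-e → e≢x (Maybe.just-injective (trans (sym ends-e) ends))
      where
      never-e : NeverBottom D T e
      never-e (ω₃ , ω₃∈D , ends₃) = not-overtaken (ω₃ , ω₃∈D , position ω e , e<p ,
          subst (λ y → position ω₃ a Fin.< position ω₃ y) (sym (lookup-position ω-pref e)) a-before-e)
        where
        e<p : position ω e Fin.< p
        e<p = Fin.≤∧≢⇒< (within-p e e∈T) (e≢a ∘ at-p⇒a)
        a-before-e : position ω₃ a Fin.< position ω₃ e
        a-before-e = Fin.≤∧≢⇒< (proj₂ (restrict-last⇒RanksLast (D-pref ω₃∈D) T ends₃) a a∈T)
          (λ a↦e → e≢a (sym (position-injective (D-pref ω₃∈D) a↦e)))

  appears-pred : ∀ {k a} → Appears (suc k) a → Appears k a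
  appears-pred (ω , ω∈D , p , p≡1+k , refl) with overtaken? ω p
  ... | yes overtaken     = overtaken⇒appears-pred ω∈D p≡1+k overtaken
  ... | no not-overtaken  = ¬overtaken⇒appears-pred ω∈D p≡1+k not-overtaken

  appears-≤ : ∀ {m k a} → k ≤ m → Appears m a → Appears k a
  appears-≤ {zero}  z≤n     appears = appears
  appears-≤ {suc m} k≤1+m   appears with ℕ.m≤n⇒m<n∨m≡n k≤1+m
  ... | inj₁ (s≤s k≤m) = appears-≤ k≤m (appears-pred appears)
  ... | inj₂ refl      = appears

  D-nonempty : ∃ λ ω → D ω ≡ true
  D-nonempty with ∃Vec? (λ ω → D ω Bool.≟ true)
  ... | yes nonempty = nonempty
  ... | no empty = contradiction (identity , maximal-∋-admissible D-max identity-pref admissible) empty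
    where
    identity : Word n
    identity = tabulate (λ i → i)
    identity-pref : Unique identity
    identity-pref = tabulate⁺ (λ eq → eq)
    admissible : Admissible D identity
    admissible T ∣T∣≡3 x _ _ ends with member-avoiding T ∣T∣≡3 x x
    ... | e , e∈T , e≢x , _ = e , e∈T , (λ (ω , ω∈D , _) → empty (ω , ω∈D)) ,
                              λ ends-e → e≢x (Maybe.just-injective (trans (sym ends-e) ends))

  appears-0 : ∀ a → Appears 0 a
  appears-0 a = appears-≤ z≤n (ω , ω∈D , position ω a , refl , lookup-position (D-pref ω∈D) a)
    where
    ω : Word n
    ω = proj₁ D-nonempty
    ω∈D : D ω ≡ true
    ω∈D = proj₂ D-nonempty

  AllAppear : ℕ → Set
  AllAppear k = ∀ a → Appears k a

  record Threshold (r : ℕ) : Set where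
    field
      positive : 1 ≤ r
      bounded  : r ≤ n
      below    : ∀ k → k < r → AllAppear k
      at       : r ≡ n ⊎ (r < n × ∃ λ a → ¬ Appears r a)

  threshold : 1 ≤ n → ∃ Threshold
  threshold 1≤n with Fin.all? (λ (i : Fin n) → Fin.all? (appears? (toℕ i)))
  ... | yes all = n , record
    { positive = 1≤n
    ; bounded  = ℕ.≤-refl
    ; below    = λ k k<n → subst AllAppear (Fin.toℕ-fromℕ< k<n) (all (fromℕ< k<n))
    ; at       = inj₁ refl
    }
  ... | no ¬all with Fin.¬∀⟶∃¬-smallest n _ (λ i → Fin.all? (appears? (toℕ i))) ¬all
  ...   | i , ¬all-i , all-before with Fin.¬∀⟶∃¬ n _ (appears? (toℕ i)) ¬all-i
  ...     | a , ¬appears = toℕ i , record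
    { positive = ℕ.n≢0⇒n>0 λ i≡0 → ¬appears (subst (λ k → Appears k a) (sym i≡0) (appears-0 a))
    ; bounded  = ℕ.<⇒≤ (Fin.toℕ<n i)
    ; below    = λ k k<i → subst AllAppear (trans (Fin.toℕ-inject (fromℕ< k<i)) (Fin.toℕ-fromℕ< k<i))
                                  (all-before (fromℕ< k<i))
    ; at       = inj₂ (Fin.toℕ<n i , a , ¬appears)
    }

  module _ {r} (t : Threshold r) where
    open Threshold t

    threshold-rich : RichIs D r
    threshold-rich = (bounded , λ j j<r a → found (below (toℕ j) j<r a)) , not-richer at
      where
      found : ∀ {j a} → Appears (toℕ j) a → ∃ λ ω → D ω ≡ true × lookup ω j ≡ a
      found (ω , ω∈D , j′ , j′≡j , ωⱼ′≡a) =
        ω , ω∈D , trans (cong (lookup ω) (Fin.toℕ-injective (sym j′≡j))) ωⱼ′≡a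
      not-richer : r ≡ n ⊎ (r < n × ∃ λ a → ¬ Appears r a) → ¬ IsRich D (suc r)
      not-richer (inj₁ refl)               (1+r≤r , _) = ℕ.n≮n r 1+r≤r
      not-richer (inj₂ (r<n , a , ¬appears)) (_ , rich)
        with rich (fromℕ< r<n) (subst (_< suc r) (sym (Fin.toℕ-fromℕ< r<n)) (ℕ.n<1+n r)) a
      ... | ω , ω∈D , ωᵣ≡a = ¬appears (ω , ω∈D , fromℕ< r<n , Fin.toℕ-fromℕ< r<n , ωᵣ≡a)

    threshold-level : LevelIntersectionNonempty D r
    threshold-level with at
    ... | inj₁ refl = fromℕ< positive , λ S _ ∣S∣≡n →
                      subst (fromℕ< positive ∈_) (sym (Subset.∣p∣≡n⇒p≡⊤ ∣S∣≡n)) Subset.∈⊤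
    ... | inj₂ (_ , a , ¬appears) = a , a∈level
      where
      a∈level : ∀ S → InV D S → ∣ S ∣ ≡ r → a ∈ S
      a∈level S (ω , ω∈D , k , _ , k≤n , refl) ∣S∣≡r = ∈prefix⁺ ω-pref (ℕ.≰⇒> λ k≤a →
        ¬appears (appears-≤ (subst (_≤ toℕ (position ω a)) k≡r k≤a)
                            (ω , ω∈D , position ω a , refl , lookup-position ω-pref a)))
        where
        ω-pref : Unique ω
        ω-pref = D-pref ω∈D
        k≡r : k ≡ r
        k≡r = trans (sym (∣prefix∣ ω ω-pref k≤n)) ∣S∣≡r

    threshold-minimal : ∀ k → 1 ≤ k → k ≤ n → LevelIntersectionNonempty D k → r ≤ k
    threshold-minimal k 1≤k k≤n (a , a∈all) = ℕ.≮⇒≥ λ k<r → a∉position-k (below k k<r a)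
      where
      a∉position-k : ¬ Appears k a
      a∉position-k (ω , ω∈D , j , j≡k , ωⱼ≡a) =
        ℕ.n≮n k (subst (_< k) a↦k (∈prefix⁻ ω-pref a∈prefix))
        where
        ω-pref : Unique ω
        ω-pref = D-pref ω∈D
        a∈prefix : a ∈ prefixSet ω k
        a∈prefix = a∈all (prefixSet ω k) (ω , ω∈D , k , 1≤k , k≤n , refl) (∣prefix∣ ω ω-pref k≤n)
        a↦k : toℕ (position ω a) ≡ k
        a↦k = trans (cong (toℕ ∘ position ω) (sym ωⱼ≡a))
                    (trans (cong toℕ (position-lookup ω-pref j)) j≡k)

theorem5p6 : (n : ℕ) → 1 ≤ n → (D : Domain n) → IsMaximalASPD D →
    Σ ℕ λ r → RichIs D r × IsMinIn[n] n (LevelIntersectionNonempty D) r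
theorem5p6 n 1≤n D D-max with threshold D-max 1≤n
... | r , t =
  r , threshold-rich D-max t ,
  (positive , bounded , threshold-level D-max t) , threshold-minimal D-max t
  where open Threshold t
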